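{- Let $l\ge2$, $n\ge2$ and $N=l^n$. Then the $2l^{n-1}$-tuple $(l,l,\dots,l)\in(\mathbb{Z}/N\mathbb{Z})^{2l^{n-1}}$ is a solution of $(E_N)$.
   Context: For $a_1,\dots,a_m\in\mathbb{Z}/N\mathbb{Z}$ set $M_m(a_1,\dots,a_m)=\begin{pmatrix}a_m&-1\\1&0\end{pmatrix}\cdots\begin{pmatrix}a_1&-1\\1&0\end{pmatrix}$. An $m$-tuple is a solution of $(E_N)$ if $M_m(a_1,\dots,a_m)=\pm\mathrm{Id}$ over $\mathbb{Z}/N\mathbb{Z}$. -}

module Defs where

open import Data.Nat using (ℕ)
open import Data.Integer using (ℤ; +_; _+_; _-_; _*_; -_; 0ℤ; 1ℤ)
open import Data.Integer.Divisibility using (_∣_)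
open import Data.List using (List; []; _∷_; foldl)
open import Data.Product using (_×_)
open import Data.Sum using (_⊎_)

record Mat2 : Set where
  constructor mat
  field
    a b c d : ℤ

open Mat2 public

_⊗_ : Mat2 → Mat2 → Mat2
mat a₁ b₁ c₁ d₁ ⊗ mat a₂ b₂ c₂ d₂ =
  mat (a₁ * a₂ + b₁ * c₂) (a₁ * b₂ + b₁ * d₂)
      (c₁ * a₂ + d₁ * c₂) (c₁ * b₂ + d₁ * d₂)

Id₂ : Mat2
Id₂ = mat 1ℤ 0ℤ 0ℤ 1ℤ

Step : ℤ → Mat2
Step x = mat x (- 1ℤ) 1ℤ 0ℤ

-- M_m(a₁,…,aₘ) = Step aₘ ⋯ Step a₁  (list given in order a₁ ∷ … ∷ aₘ ∷ [])
M : List ℤ → Mat2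
M = foldl (λ acc x → Step x ⊗ acc) Id₂

_≡_[mod_] : ℤ → ℤ → ℕ → Set
x ≡ y [mod N ] = (+ N) ∣ (x - y)

_≅_[mod_] : Mat2 → Mat2 → ℕ → Set
A ≅ B [mod N ] =
  (a A ≡ a B [mod N ]) × (b A ≡ b B [mod N ]) ×
  (c A ≡ c B [mod N ]) × (d A ≡ d B [mod N ])

neg : Mat2 → Mat2
neg (mat x y z w) = mat (- x) (- y) (- z) (- w)

-- (a₁,…,aₘ) is a solution of (E_N): M_m(a₁,…,aₘ) = ± Id over ℤ/Nℤ
IsSolution : ℕ → List ℤ → Set
IsSolution N as = (M as ≅ Id₂ [mod N ]) ⊎ (M as ≅ neg Id₂ [mod N ])

-- The matrix S = Step l is a root of its characteristic polynomial
-- X² − l X + 1, so the m-fold product M(l, …, l) = Sᵐ is the image of ξᵐ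
-- under ℤ[ξ]/(ξ² − l ξ + 1) → Mat₂(ℤ), ξ ↦ S.  In that ring
-- ξ² = −(1 − l ξ) ≡ −1 (mod l), and taking l-th powers lifts a congruence
-- u ≡ ±1 (mod l r) to u^l ≡ ±1 (mod l² r), because
-- (1 + q z)^l = 1 + l q z + q² w.  By induction ξ^(2 l^j) ≡ ±1 (mod l^(j+1)).
module Submission where

open import Defs
open import Data.Nat as ℕ using (ℕ; zero; suc)
import Data.Nat.Properties as ℕₚ
open import Data.Integer using (ℤ; +_; -_; 0ℤ; 1ℤ; _+_; _-_)
open import Data.Integer.Properties
  using (neg-distrib-+; neg-distribˡ-*; neg-involutive; pos-*; -1*i≡-i; +-identityʳ; *-identityˡ)
open import Data.Integer.Divisibility using (_∣_)
open import Data.Integer.Divisibility.Signed using (divides; ∣⇒∣ᵤ; ∣ᵤ⇒∣; ∣m⇒∣-m)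
open import Data.Integer.Tactic.RingSolver using (solve)
open import Data.List using ([]; _∷_; foldl; replicate)
open import Data.Product using (_,_; ∃-syntax)
open import Data.Sum using (_⊎_; inj₁; inj₂)
open import Relation.Binary.PropositionalEquality
open ≡-Reasoning

≡-mod-neg : ∀ {q} {x y : ℤ} → x ≡ y [mod q ] → (- x) ≡ (- y) [mod q ]
≡-mod-neg {q} {x} {y} x≡y =
  subst (λ z → + q ∣ z) (neg-distrib-+ x (- y)) (∣⇒∣ᵤ (∣m⇒∣-m {+ q} {x - y} (∣ᵤ⇒∣ x≡y)))

≅-mod-neg : ∀ {q A B} → A ≅ B [mod q ] → neg A ≅ neg B [mod q ]
≅-mod-neg {A = mat a b c d} {mat a′ b′ c′ d′} (a≡a′ , b≡b′ , c≡c′ , d≡d′) =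
  ≡-mod-neg {x = a} {a′} a≡a′ , ≡-mod-neg {x = b} {b′} b≡b′ ,
  ≡-mod-neg {x = c} {c′} c≡c′ , ≡-mod-neg {x = d} {d′} d≡d′

mat-cong : ∀ {a a′ b b′ c c′ d d′} →
  a ≡ a′ → b ≡ b′ → c ≡ c′ → d ≡ d′ → mat a b c d ≡ mat a′ b′ c′ d′
mat-cong refl refl refl refl = refl

-- a +ξ b stands for a + b ξ, where ξ² = L ξ − 1.
module QuadraticOrder (L : ℤ) where
  open import Data.Integer using (_*_)

  infix 6 _+ξ_

  data R : Set where
    _+ξ_ : ℤ → ℤ → R

  infixr 8 _^ᴿ_
  infix  8 -ᴿ_
  infixl 7 _·_
  infixr 7 _∙_
  infixl 6 _+ᴿ_

  _·_ : R → R → R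
  (a +ξ b) · (c +ξ d) = (a * c - b * d) +ξ (a * d + b * c + L * b * d)

  _+ᴿ_ : R → R → R
  (a +ξ b) +ᴿ (c +ξ d) = (a + c) +ξ (b + d)

  _∙_ : ℤ → R → R
  q ∙ (a +ξ b) = (q * a) +ξ (q * b)

  -ᴿ_ : R → R
  -ᴿ (a +ξ b) = (- a) +ξ (- b)

  1ᴿ ξ : R
  1ᴿ = (1ℤ +ξ 0ℤ)
  ξ  = (0ℤ +ξ 1ℤ)

  _^ᴿ_ : R → ℕ → R
  x ^ᴿ zero  = 1ᴿ
  x ^ᴿ suc m = x · x ^ᴿ m

  ·-assoc : ∀ x y z → x · y · z ≡ x · (y · z)
  ·-assoc (a +ξ b) (c +ξ d) (e +ξ f) =
    cong₂ _+ξ_ (solve (a ∷ b ∷ c ∷ d ∷ e ∷ f ∷ L ∷ [])) (solve (a ∷ b ∷ c ∷ d ∷ e ∷ f ∷ L ∷ []))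

  ·-comm : ∀ x y → x · y ≡ y · x
  ·-comm (a +ξ b) (c +ξ d) =
    cong₂ _+ξ_ (solve (a ∷ b ∷ c ∷ d ∷ [])) (solve (a ∷ b ∷ c ∷ d ∷ L ∷ []))

  ·-identityˡ : ∀ x → 1ᴿ · x ≡ x
  ·-identityˡ (a +ξ b) = cong₂ _+ξ_ (solve (a ∷ b ∷ [])) (solve (a ∷ b ∷ L ∷ []))

  ·-identityʳ : ∀ x → x · 1ᴿ ≡ x
  ·-identityʳ x = trans (·-comm x 1ᴿ) (·-identityˡ x)

  -ᴿ-distribˡ-· : ∀ x y → (-ᴿ x) · y ≡ -ᴿ (x · y)
  -ᴿ-distribˡ-· (a +ξ b) (c +ξ d) =
    cong₂ _+ξ_ (solve (a ∷ b ∷ c ∷ d ∷ [])) (solve (a ∷ b ∷ c ∷ d ∷ L ∷ []))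

  -ᴿ-distribʳ-· : ∀ x y → x · (-ᴿ y) ≡ -ᴿ (x · y)
  -ᴿ-distribʳ-· (a +ξ b) (c +ξ d) =
    cong₂ _+ξ_ (solve (a ∷ b ∷ c ∷ d ∷ [])) (solve (a ∷ b ∷ c ∷ d ∷ L ∷ []))

  -ᴿ-involutive : ∀ x → -ᴿ (-ᴿ x) ≡ x
  -ᴿ-involutive (a +ξ b) = cong₂ _+ξ_ (neg-involutive a) (neg-involutive b)

  ^ᴿ-distribˡ-+-· : ∀ x m n → x ^ᴿ (m ℕ.+ n) ≡ x ^ᴿ m · x ^ᴿ n
  ^ᴿ-distribˡ-+-· x zero    n = sym (·-identityˡ (x ^ᴿ n))
  ^ᴿ-distribˡ-+-· x (suc m) n =
    trans (cong (x ·_) (^ᴿ-distribˡ-+-· x m n)) (sym (·-assoc x (x ^ᴿ m) (x ^ᴿ n)))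

  ^ᴿ-*-assoc : ∀ x m n → (x ^ᴿ m) ^ᴿ n ≡ x ^ᴿ (m ℕ.* n)
  ^ᴿ-*-assoc x m zero    = cong (x ^ᴿ_) (sym (ℕₚ.*-zeroʳ m))
  ^ᴿ-*-assoc x m (suc n) = begin
    x ^ᴿ m · (x ^ᴿ m) ^ᴿ n  ≡⟨ cong (x ^ᴿ m ·_) (^ᴿ-*-assoc x m n) ⟩
    x ^ᴿ m · x ^ᴿ (m ℕ.* n) ≡⟨ ^ᴿ-distribˡ-+-· x m (m ℕ.* n) ⟨
    x ^ᴿ (m ℕ.+ m ℕ.* n)    ≡⟨ cong (x ^ᴿ_) (ℕₚ.*-suc m n) ⟨
    x ^ᴿ (m ℕ.* suc n)      ∎

  -ᴿ-^ᴿ : ∀ x k → (-ᴿ x) ^ᴿ k ≡ x ^ᴿ k ⊎ (-ᴿ x) ^ᴿ k ≡ -ᴿ (x ^ᴿ k)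
  -ᴿ-^ᴿ x zero = inj₁ refl
  -ᴿ-^ᴿ x (suc k) with -ᴿ-^ᴿ x k
  ... | inj₁ even = inj₂ (trans (cong ((-ᴿ x) ·_) even) (-ᴿ-distribˡ-· x (x ^ᴿ k)))
  ... | inj₂ odd  = inj₁ (begin
    (-ᴿ x) · (-ᴿ x) ^ᴿ k      ≡⟨ cong ((-ᴿ x) ·_) odd ⟩
    (-ᴿ x) · (-ᴿ (x ^ᴿ k))   ≡⟨ -ᴿ-distribˡ-· x (-ᴿ (x ^ᴿ k)) ⟩
    -ᴿ (x · (-ᴿ (x ^ᴿ k)))   ≡⟨ cong -ᴿ_ (-ᴿ-distribʳ-· x (x ^ᴿ k)) ⟩
    -ᴿ (-ᴿ (x · x ^ᴿ k))     ≡⟨ -ᴿ-involutive (x · x ^ᴿ k) ⟩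
    x · x ^ᴿ k               ∎)

  1+∙-·-1+∙ : ∀ q K z w →
    (1ᴿ +ᴿ q ∙ z) · (1ᴿ +ᴿ (K * q) ∙ z +ᴿ (q * q) ∙ w)
      ≡ 1ᴿ +ᴿ ((1ℤ + K) * q) ∙ z +ᴿ (q * q) ∙ (K ∙ (z · z) +ᴿ w +ᴿ q ∙ (z · w))
  1+∙-·-1+∙ q K (z₁ +ξ z₂) (w₁ +ξ w₂) =
    cong₂ _+ξ_ (solve (q ∷ K ∷ z₁ ∷ z₂ ∷ w₁ ∷ w₂ ∷ L ∷ []))
              (solve (q ∷ K ∷ z₁ ∷ z₂ ∷ w₁ ∷ w₂ ∷ L ∷ []))

  1+∙-^ᴿ : ∀ q z k → ∃[ w ] (1ᴿ +ᴿ q ∙ z) ^ᴿ k ≡ 1ᴿ +ᴿ (+ k * q) ∙ z +ᴿ (q * q) ∙ w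
  1+∙-^ᴿ q (z₁ +ξ z₂) zero =
    (0ℤ +ξ 0ℤ) , cong₂ _+ξ_ (solve (q ∷ z₁ ∷ [])) (solve (q ∷ z₂ ∷ []))
  1+∙-^ᴿ q z (suc k) with 1+∙-^ᴿ q z k
  ... | w , eq = _ , trans (cong ((1ᴿ +ᴿ q ∙ z) ·_) eq) (1+∙-·-1+∙ q (+ k) z w)

  -- (k r)² = k · k r · r: this is where the modulus being a multiple of k is used.
  1+∙-^ᴿ-lift : ∀ k r z → ∃[ z′ ] (1ᴿ +ᴿ + (k ℕ.* r) ∙ z) ^ᴿ k ≡ 1ᴿ +ᴿ + (k ℕ.* (k ℕ.* r)) ∙ z′
  1+∙-^ᴿ-lift k r z with 1+∙-^ᴿ (+ (k ℕ.* r)) z k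
  ... | w , eq = z +ᴿ + r ∙ w , (begin
    (1ᴿ +ᴿ + (k ℕ.* r) ∙ z) ^ᴿ k
      ≡⟨ eq ⟩
    1ᴿ +ᴿ (+ k * + (k ℕ.* r)) ∙ z +ᴿ (+ (k ℕ.* r) * + (k ℕ.* r)) ∙ w
      ≡⟨ cong (λ q → 1ᴿ +ᴿ (+ k * q) ∙ z +ᴿ (q * q) ∙ w) (pos-* k r) ⟩
    1ᴿ +ᴿ (+ k * (+ k * + r)) ∙ z +ᴿ ((+ k * + r) * (+ k * + r)) ∙ w
      ≡⟨ factor (+ k) (+ r) z w ⟩
    1ᴿ +ᴿ (+ k * (+ k * + r)) ∙ (z +ᴿ + r ∙ w)
      ≡⟨ cong (λ q → 1ᴿ +ᴿ q ∙ (z +ᴿ + r ∙ w)) (trans (pos-* k (k ℕ.* r)) (cong (+ k *_) (pos-* k r))) ⟨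
    1ᴿ +ᴿ + (k ℕ.* (k ℕ.* r)) ∙ (z +ᴿ + r ∙ w) ∎)
    where
    factor : ∀ K r z w →
      1ᴿ +ᴿ (K * (K * r)) ∙ z +ᴿ ((K * r) * (K * r)) ∙ w ≡ 1ᴿ +ᴿ (K * (K * r)) ∙ (z +ᴿ r ∙ w)
    factor K r (z₁ +ξ z₂) (w₁ +ξ w₂) =
      cong₂ _+ξ_ (solve (K ∷ r ∷ z₁ ∷ w₁ ∷ [])) (solve (K ∷ r ∷ z₂ ∷ w₂ ∷ []))

  infix 4 _≡±1[mod_]

  data _≡±1[mod_] (u : R) (q : ℤ) : Set where
    ≡+1 : ∀ z → u ≡ 1ᴿ +ᴿ q ∙ z → u ≡±1[mod q ]
    ≡-1 : ∀ z → u ≡ -ᴿ (1ᴿ +ᴿ q ∙ z) → u ≡±1[mod q ]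

  ^ᴿ-lift-≡±1 : ∀ k r {u} → u ≡±1[mod + (k ℕ.* r) ] → u ^ᴿ k ≡±1[mod + (k ℕ.* (k ℕ.* r)) ]
  ^ᴿ-lift-≡±1 k r (≡+1 z refl) with 1+∙-^ᴿ-lift k r z
  ... | z′ , eq = ≡+1 z′ eq
  ^ᴿ-lift-≡±1 k r (≡-1 z refl) with 1+∙-^ᴿ-lift k r z | -ᴿ-^ᴿ (1ᴿ +ᴿ + (k ℕ.* r) ∙ z) k
  ... | z′ , eq | inj₁ even = ≡+1 z′ (trans even eq)
  ... | z′ , eq | inj₂ odd  = ≡-1 z′ (trans odd (cong -ᴿ_ eq))

  ξ^2≡±1 : ξ ^ᴿ 2 ≡±1[mod L ]
  ξ^2≡±1 = ≡-1 (0ℤ +ξ - 1ℤ) (cong₂ _+ξ_ (solve (L ∷ [])) (solve (L ∷ [])))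

  Step-⊗-mat : ∀ x p q r s → Step x ⊗ mat p q r s ≡ mat (x * p - r) (x * q - s) p q
  Step-⊗-mat x p q r s =
    mat-cong (cong (_+_ (x * p)) (-1*i≡-i r)) (cong (_+_ (x * q)) (-1*i≡-i s)) (1*p+0*r≡p p r) (1*p+0*r≡p q s)
    where
    1*p+0*r≡p : ∀ p r → 1ℤ * p + 0ℤ * r ≡ p
    1*p+0*r≡p p r = trans (+-identityʳ (1ℤ * p)) (*-identityˡ p)

  -- a + b ξ ↦ a · Id₂ + b · Step L
  toMat : R → Mat2
  toMat (a +ξ b) = mat (a + b * L) (- b) b a

  toMat-1ᴿ : toMat 1ᴿ ≡ Id₂
  toMat-1ᴿ = mat-cong (solve (L ∷ [])) refl refl refl

  toMat--ᴿ : ∀ u → toMat (-ᴿ u) ≡ neg (toMat u)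
  toMat--ᴿ (a +ξ b) =
    mat-cong (sym (trans (neg-distrib-+ a (b * L)) (cong (_+_ (- a)) (neg-distribˡ-* b L)))) refl refl refl

  Step-⊗-toMat : ∀ u → Step L ⊗ toMat u ≡ toMat (ξ · u)
  Step-⊗-toMat (a +ξ b) = trans (Step-⊗-mat L _ _ _ _) (mat-cong
    (solve (a ∷ b ∷ L ∷ [])) (solve (a ∷ b ∷ L ∷ [])) (solve (a ∷ b ∷ L ∷ [])) (solve (a ∷ b ∷ [])))

  step : Mat2 → ℤ → Mat2
  step A x = Step x ⊗ A

  foldl-step-replicate : ∀ m u → foldl step (toMat u) (replicate m L) ≡ toMat (ξ ^ᴿ m · u)
  foldl-step-replicate zero    u = cong toMat (sym (·-identityˡ u))
  foldl-step-replicate (suc m) u = begin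
    foldl step (Step L ⊗ toMat u) (replicate m L)
      ≡⟨ cong (λ A → foldl step A (replicate m L)) (Step-⊗-toMat u) ⟩
    foldl step (toMat (ξ · u)) (replicate m L)
      ≡⟨ foldl-step-replicate m (ξ · u) ⟩
    toMat (ξ ^ᴿ m · (ξ · u))
      ≡⟨ cong toMat (·-assoc (ξ ^ᴿ m) ξ u) ⟨
    toMat (ξ ^ᴿ m · ξ · u)
      ≡⟨ cong (λ v → toMat (v · u)) (·-comm (ξ ^ᴿ m) ξ) ⟩
    toMat (ξ · ξ ^ᴿ m · u)
      ∎

  M-replicate : ∀ m → M (replicate m L) ≡ toMat (ξ ^ᴿ m)
  M-replicate m = begin
    foldl step Id₂ (replicate m L)         ≡⟨ cong (λ A → foldl step A (replicate m L)) toMat-1ᴿ ⟨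
    foldl step (toMat 1ᴿ) (replicate m L)  ≡⟨ foldl-step-replicate m 1ᴿ ⟩
    toMat (ξ ^ᴿ m · 1ᴿ)                    ≡⟨ cong toMat (·-identityʳ (ξ ^ᴿ m)) ⟩
    toMat (ξ ^ᴿ m)                         ∎

  toMat-1+∙-≅-Id₂ : ∀ q z → toMat (1ᴿ +ᴿ + q ∙ z) ≅ Id₂ [mod q ]
  toMat-1+∙-≅-Id₂ q (z₁ +ξ z₂) =
    ∣⇒∣ᵤ (divides (z₁ + z₂ * L) (entry-a (+ q))) , ∣⇒∣ᵤ (divides (- z₂) (entry-b (+ q))) ,
    ∣⇒∣ᵤ (divides z₂ (entry-c (+ q))) , ∣⇒∣ᵤ (divides z₁ (entry-d (+ q)))
    where
    entry-a : ∀ Q → 1ℤ + Q * z₁ + (0ℤ + Q * z₂) * L - 1ℤ ≡ (z₁ + z₂ * L) * Q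
    entry-a Q = solve (Q ∷ z₁ ∷ z₂ ∷ L ∷ [])
    entry-b : ∀ Q → - (0ℤ + Q * z₂) - 0ℤ ≡ (- z₂) * Q
    entry-b Q = solve (Q ∷ z₂ ∷ [])
    entry-c : ∀ Q → 0ℤ + Q * z₂ - 0ℤ ≡ z₂ * Q
    entry-c Q = solve (Q ∷ z₂ ∷ [])
    entry-d : ∀ Q → 1ℤ + Q * z₁ - 1ℤ ≡ z₁ * Q
    entry-d Q = solve (Q ∷ z₁ ∷ [])

  toMat-≡±1 : ∀ {q u} → u ≡±1[mod + q ] →
    (toMat u ≅ Id₂ [mod q ]) ⊎ (toMat u ≅ neg Id₂ [mod q ])
  toMat-≡±1 {q} (≡+1 z refl) = inj₁ (toMat-1+∙-≅-Id₂ q z)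
  toMat-≡±1 {q} (≡-1 z refl) = inj₂
    (subst (_≅ neg Id₂ [mod q ]) (sym (toMat--ᴿ v))
      (≅-mod-neg {A = toMat v} {Id₂} (toMat-1+∙-≅-Id₂ q z)))
    where
    v = 1ᴿ +ᴿ + q ∙ z

open import Data.Nat using (_≤_; _^_; _∸_; _*_)

2*l^suc≡2*l^*l : ∀ l j → 2 * l ^ suc j ≡ 2 * l ^ j * l
2*l^suc≡2*l^*l l j = trans (cong (2 *_) (ℕₚ.*-comm l (l ^ j))) (sym (ℕₚ.*-assoc 2 (l ^ j) l))

module _ (l : ℕ) where
  open QuadraticOrder (+ l)

  ξ^[2l^j]≡±1 : ∀ j → ξ ^ᴿ (2 * l ^ j) ≡±1[mod + (l ^ suc j) ]
  ξ^[2l^j]≡±1 zero = subst (λ q → ξ ^ᴿ 2 ≡±1[mod + q ]) (sym (ℕₚ.*-identityʳ l)) ξ^2≡±1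
  ξ^[2l^j]≡±1 (suc j) = subst (_≡±1[mod + (l ^ suc (suc j)) ]) (sym ξ^2l^suc)
    (^ᴿ-lift-≡±1 l (l ^ j) (ξ^[2l^j]≡±1 j))
    where
    ξ^2l^suc : ξ ^ᴿ (2 * l ^ suc j) ≡ (ξ ^ᴿ (2 * l ^ j)) ^ᴿ l
    ξ^2l^suc = trans (cong (ξ ^ᴿ_) (2*l^suc≡2*l^*l l j)) (sym (^ᴿ-*-assoc ξ (2 * l ^ j) l))

proposition3p14 : (l n : ℕ) → 2 ≤ l → 2 ≤ n →
    IsSolution (l ^ n) (replicate (2 * l ^ (n ∸ 1)) (+ l))
proposition3p14 l zero    _ ()
proposition3p14 l (suc n) _ _ rewrite QuadraticOrder.M-replicate (+ l) (2 * l ^ n) =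
  toMat-≡±1 (ξ^[2l^j]≡±1 l n)
  where open QuadraticOrder (+ l)
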